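{- Let $\mathcal L_1$ and $\mathcal L_2$ be sound matrix logics and $\psi\in L_{12}(\Xi)$. If $\vdash_{12}\psi$, then $\vdash_1|\psi|_1$ and $\vdash_2|\psi|_2$.
   Context: A matrix logic is a triple $\mathcal L=(\Sigma,\Delta,\mathcal M)$: $\Sigma=\{\Sigma_n\}_{n\in\mathbb N}$ with $\Sigma_n$ a set of $n$-ary constructors; $L(\Xi)$ is the set of formulas over $\Sigma$ and the schema variables $\Xi=\{\xi_k:k\in\mathbb N\}$; $\Delta$ is a set of finitary rules $\alpha_1\dots\alpha_m/\beta$ (rules with no premises are axioms); $\Gamma\vdash\varphi$ means there is a sequence $\varphi_1,\dots,\varphi_n=\varphi$ each member of which is in $\Gamma$ or is the conclusion of a substitution instance of a rule of $\Delta$ whose premises occur earlier; $\vdash\varphi$ means $\emptyset\vdash\varphi$. $\mathcal M$ is a nonempty class of matrices $(\mathfrak A,D)$ with $\mathfrak A$ a $\Sigma$-algebra and $D$ a nonempty subset of its carrier; $\Gamma\models\varphi$ means that for every matrix of $\mathcal M$ and assignment, if every formula of $\Gamma$ denotes an element of $D$ then so does $\varphi$. $\mathcal L$ is sound if $\Gamma\vdash\varphi$ implies $\Gamma\models\varphi$. Standing assumptions on every logic: $\top,\bot\in\Sigma_0$, $\vdash\top$, $\bot\vdash\varphi$ for every $\varphi$, in every matrix $\top$ denotes a distinguished value and $\bot$ does not; for each $n\ge1$ there is $\top^n\in\Sigma_n$ with $\top^n(\varphi_1,\dots,\varphi_n)$ equivalent to $\top$ (in particular a theorem). Meet-combination $\mathcal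 L_1\mathcal L_2=(\Sigma_{12},\Delta_{12},\mathcal M_{12})$ of $\mathcal L_1=(\Sigma_1,\Delta_1,\mathcal M_1)$ and $\mathcal L_2=(\Sigma_2,\Delta_2,\mathcal M_2)$: $\Sigma_{12,n}=\{(c_1c_2):c_1\in\Sigma_{1n},c_2\in\Sigma_{2n}\}$, formulas $L_{12}(\Xi)$. Each $c_1\in\Sigma_{1n}$ is identified with $(c_1\top^n_2)$ and each $c_2\in\Sigma_{2n}$ with $(\top^n_1c_2)$ (for $n=0$, $\top^0$ means $\top$), so $L_k(\Xi)\subseteq L_{12}(\Xi)$. The projection $|\varphi|_k\in L_k(\Xi)$ replaces each combined constructor by its $k$-th component. Tagging of a rule $r=\alpha_1\dots\alpha_m/\beta$ of $\mathcal L_k$: if $\beta$ is not a schema variable, $\overline r=\{r\}$; if $\beta$ is a schema variable, $\overline r$ consists, for each $n$ and each $c\in\Sigma_{kn}$, of the rule $\rho_{r,c}(\alpha_1)\dots\rho_{r,c}(\alpha_m)/\rho_{r,c}(\beta)$ where $\rho_{r,c}(\beta)=c(\xi_{j+1},\dots,\xi_{j+n})$, $j$ the maximum index of schema variables occurring in $r$, and $\rho_{r,c}$ fixes all other variables. $\Delta_{12}$ consists of: all rules in $\overline{\Delta_1}\cup\overline{\Delta_2}$ (via the identifications); the lifting rules $|\varphi|_1\ |\varphi|_2/\varphi$ and co-lifting rules $\varphi/|\varphi|_k$ ($k=1,2$) for every $\varphi\in L_{12}(\Xi)$; and $\bot_1/\bot_2$, $\bot_2/\bot_1$. $\mathcal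 M_{12}$ is the class of product matrices $(\mathfrak A_1\times\mathfrak A_2,D_1\times D_2)$, $(\mathfrak A_k,D_k)\in\mathcal M_k$, with $(c_1c_2)$ interpreted componentwise. $\vdash_{12}$ denotes derivability in $\mathcal L_1\mathcal L_2$. -}

module Defs where

open import Data.Nat using (ℕ; zero; suc; _+_; _≟_) renaming (_⊔_ to _⊔ℕ_)
open import Data.Fin using (Fin; toℕ)
open import Data.Vec using (Vec; []; _∷_; tabulate)
open import Data.List using (List; []; _∷_)
open import Data.List.Relation.Unary.All using (All)
open import Data.List.Membership.Propositional using (_∈_)
open import Data.Product using (Σ; _×_; _,_; proj₁; proj₂; ∃)
open import Data.Sum using (_⊎_)
open import Data.Empty using (⊥)
open import Relation.Nullary using (¬_; yes; no)
open import Relation.Binary.PropositionalEquality using (_≡_; refl)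

-- Formulas over a signature C (C n = set of n-ary constructors) and the
-- schema variables ξ_k, represented as var k (k ∈ ℕ).

data Fm (C : ℕ → Set) : Set where
  var : ℕ → Fm C
  app : ∀ {n} → C n → Vec (Fm C) n → Fm C

module _ {C : ℕ → Set} where

  mutual
    sub : (ℕ → Fm C) → Fm C → Fm C
    sub σ (var i)    = σ i
    sub σ (app c as) = app c (subs σ as)

    subs : ∀ {n} → (ℕ → Fm C) → Vec (Fm C) n → Vec (Fm C) n
    subs σ []       = []
    subs σ (a ∷ as) = sub σ a ∷ subs σ as

  mutual
    maxVar : Fm C → ℕ
    maxVar (var i)    = i
    maxVar (app c as) = maxVars as

    maxVars : ∀ {n} → Vec (Fm C) n → ℕ
    maxVars []       = 0
    maxVars (a ∷ as) = maxVar a ⊔ℕ maxVars as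

  IsVar : Fm C → Set
  IsVar φ = ∃ λ i → φ ≡ var i

record Rule (C : ℕ → Set) : Set where
  constructor _⇒_
  field
    prems : List (Fm C)
    concl : Fm C
open Rule public

module _ {C : ℕ → Set} where

  maxVarList : List (Fm C) → ℕ
  maxVarList []       = 0
  maxVarList (a ∷ as) = maxVar a ⊔ℕ maxVarList as

  maxVarRule : Rule C → ℕ
  maxVarRule r = maxVarList (prems r) ⊔ℕ maxVar (concl r)

  subList : (ℕ → Fm C) → List (Fm C) → List (Fm C)
  subList σ []       = []
  subList σ (a ∷ as) = sub σ a ∷ subList σ as

  subRule : (ℕ → Fm C) → Rule C → Rule C
  subRule σ (ps ⇒ β) = subList σ ps ⇒ sub σ β

  -- A sequence φ₁ … φₙ is stored reversed:
  -- (φₙ ∷ … ∷ φ₁ ∷ []).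

  module Derivations (Δ : Rule C → Set) (Γ : Fm C → Set) where

    Justified : List (Fm C) → Fm C → Set
    Justified earlier φ =
      Γ φ ⊎
      Σ (Rule C) λ r → Δ r × Σ (ℕ → Fm C) λ σ →
        (sub σ (concl r) ≡ φ) × All (λ α → sub σ α ∈ earlier) (prems r)

    data ValidSeq : List (Fm C) → Set where
      []  : ValidSeq []
      _∷_ : ∀ {φ earlier} → Justified earlier φ → ValidSeq earlier →
            ValidSeq (φ ∷ earlier)

    Derivable : Fm C → Set
    Derivable φ = Σ (List (Fm C)) λ earlier → ValidSeq (φ ∷ earlier)

record Matrix (C : ℕ → Set) : Set₁ where
  field
    Carrier    : Set
    op         : ∀ {n} → C n → Vec Carrier n → Carrier
    D          : Carrier → Set
    D-nonempty : Σ Carrier D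

  mutual
    eval : (ℕ → Carrier) → Fm C → Carrier
    eval ρ (var i)    = ρ i
    eval ρ (app c as) = op c (evals ρ as)

    evals : ∀ {n} → (ℕ → Carrier) → Vec (Fm C) n → Vec Carrier n
    evals ρ []       = []
    evals ρ (a ∷ as) = eval ρ a ∷ evals ρ as

record MatrixLogic : Set₂ where
  field
    Con        : ℕ → Set
    Δ          : Rule Con → Set
    𝓜          : Matrix Con → Set₁
    𝓜-nonempty : Σ (Matrix Con) 𝓜

module _ (L : MatrixLogic) where
  open MatrixLogic L

  _⊢_ : (Fm Con → Set) → Fm Con → Set
  Γ ⊢ φ = Derivations.Derivable Δ Γ φ

  Thm : Fm Con → Set
  Thm φ = (λ _ → ⊥) ⊢ φ

  _⊨_ : (Fm Con → Set) → Fm Con → Set₁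
  Γ ⊨ φ = (m : Matrix Con) → 𝓜 m → let open Matrix m in
          (ρ : ℕ → Carrier) → (∀ γ → Γ γ → D (eval ρ γ)) → D (eval ρ φ)

  Sound : Set₁
  Sound = ∀ Γ φ → Γ ⊢ φ → Γ ⊨ φ

  ⟦_⟧ : Fm Con → (Fm Con → Set)
  ⟦ φ ⟧ = λ ψ → ψ ≡ φ

  record Standing : Set₁ where
    field
      tt   : Con 0
      ff   : Con 0
      topⁿ : ∀ n → Con (suc n)
      ⊢tt  : Thm (app tt [])
      ff⊢  : ∀ φ → ⟦ app ff [] ⟧ ⊢ φ
      tt-designated   : (m : Matrix Con) → 𝓜 m → Matrix.D m (Matrix.op m tt [])
      ff-undesignated : (m : Matrix Con) → 𝓜 m → ¬ Matrix.D m (Matrix.op m ff [])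
      topⁿ⊢tt : ∀ n (φs : Vec (Fm Con) (suc n)) → ⟦ app (topⁿ n) φs ⟧ ⊢ app tt []
      tt⊢topⁿ : ∀ n (φs : Vec (Fm Con) (suc n)) → ⟦ app tt [] ⟧ ⊢ app (topⁿ n) φs

    ⊤^ : ∀ n → Con n
    ⊤^ zero    = tt
    ⊤^ (suc n) = topⁿ n

    ⊥F : Fm Con
    ⊥F = app ff []

module Combination (L₁ L₂ : MatrixLogic)
                   (S₁ : Standing L₁) (S₂ : Standing L₂) where
  private
    module L₁ = MatrixLogic L₁
    module L₂ = MatrixLogic L₂
    module S₁ = Standing S₁
    module S₂ = Standing S₂
    C₁ = L₁.Con
    C₂ = L₂.Con

  C₁₂ : ℕ → Set
  C₁₂ n = C₁ n × C₂ n

  mutual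
    emb₁ : Fm C₁ → Fm C₁₂
    emb₁ (var i)             = var i
    emb₁ (app {n} c as)      = app (c , S₂.⊤^ n) (embs₁ as)

    embs₁ : ∀ {n} → Vec (Fm C₁) n → Vec (Fm C₁₂) n
    embs₁ []       = []
    embs₁ (a ∷ as) = emb₁ a ∷ embs₁ as

  mutual
    emb₂ : Fm C₂ → Fm C₁₂
    emb₂ (var i)             = var i
    emb₂ (app {n} c as)      = app (S₁.⊤^ n , c) (embs₂ as)

    embs₂ : ∀ {n} → Vec (Fm C₂) n → Vec (Fm C₁₂) n
    embs₂ []       = []
    embs₂ (a ∷ as) = emb₂ a ∷ embs₂ as

  mutual
    ∣_∣₁ : Fm C₁₂ → Fm C₁
    ∣ var i ∣₁            = var i
    ∣ app (c₁ , c₂) as ∣₁ = app c₁ (projs₁ as)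

    projs₁ : ∀ {n} → Vec (Fm C₁₂) n → Vec (Fm C₁) n
    projs₁ []       = []
    projs₁ (a ∷ as) = ∣ a ∣₁ ∷ projs₁ as

  mutual
    ∣_∣₂ : Fm C₁₂ → Fm C₂
    ∣ var i ∣₂            = var i
    ∣ app (c₁ , c₂) as ∣₂ = app c₂ (projs₂ as)

    projs₂ : ∀ {n} → Vec (Fm C₁₂) n → Vec (Fm C₂) n
    projs₂ []       = []
    projs₂ (a ∷ as) = ∣ a ∣₂ ∷ projs₂ as

  embList₁ : List (Fm C₁) → List (Fm C₁₂)
  embList₁ []       = []
  embList₁ (a ∷ as) = emb₁ a ∷ embList₁ as

  embList₂ : List (Fm C₂) → List (Fm C₁₂)
  embList₂ []       = []
  embList₂ (a ∷ as) = emb₂ a ∷ embList₂ as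

  embRule₁ : Rule C₁ → Rule C₁₂
  embRule₁ (ps ⇒ β) = embList₁ ps ⇒ emb₁ β

  embRule₂ : Rule C₂ → Rule C₁₂
  embRule₂ (ps ⇒ β) = embList₂ ps ⇒ emb₂ β

  -- ρ_{r,c}: sends the variable ξᵢ (the conclusion of r) to
  -- c(ξ_{j+1},…,ξ_{j+n}), j = maximum index of variables in r, and fixes
  -- all other variables.
  ρ : {C : ℕ → Set} → Rule C → ℕ → ∀ {n} → C n → ℕ → Fm C
  ρ r i {n} c k with k ≟ i
  ... | yes _ = app c (tabulate λ (l : Fin n) → var (maxVarRule r + suc (toℕ l)))
  ... | no  _ = var k

  tagRule : {C : ℕ → Set} → Rule C → ℕ → ∀ {n} → C n → Rule C
  tagRule r i c = subRule (ρ r i c) r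

  data Δ₁₂ : Rule C₁₂ → Set where
    plain₁  : ∀ {r} → L₁.Δ r → ¬ IsVar (concl r) → Δ₁₂ (embRule₁ r)
    tagged₁ : ∀ {r i} → L₁.Δ r → concl r ≡ var i → ∀ {n} (c : C₁ n) →
              Δ₁₂ (embRule₁ (tagRule r i c))
    plain₂  : ∀ {r} → L₂.Δ r → ¬ IsVar (concl r) → Δ₁₂ (embRule₂ r)
    tagged₂ : ∀ {r i} → L₂.Δ r → concl r ≡ var i → ∀ {n} (c : C₂ n) →
              Δ₁₂ (embRule₂ (tagRule r i c))
    lift    : ∀ φ → Δ₁₂ ((emb₁ ∣ φ ∣₁ ∷ emb₂ ∣ φ ∣₂ ∷ []) ⇒ φ)
    colift₁ : ∀ φ → Δ₁₂ ((φ ∷ []) ⇒ emb₁ ∣ φ ∣₁)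
    colift₂ : ∀ φ → Δ₁₂ ((φ ∷ []) ⇒ emb₂ ∣ φ ∣₂)
    bot₁₂   : Δ₁₂ ((emb₁ S₁.⊥F ∷ []) ⇒ emb₂ S₂.⊥F)
    bot₂₁   : Δ₁₂ ((emb₂ S₂.⊥F ∷ []) ⇒ emb₁ S₁.⊥F)

  fsts : ∀ {A B : Set} {n} → Vec (A × B) n → Vec A n
  fsts []       = []
  fsts (x ∷ xs) = proj₁ x ∷ fsts xs

  snds : ∀ {A B : Set} {n} → Vec (A × B) n → Vec B n
  snds []       = []
  snds (x ∷ xs) = proj₂ x ∷ snds xs

  product : Matrix C₁ → Matrix C₂ → Matrix C₁₂
  product m₁ m₂ = record
    { Carrier    = M₁.Carrier × M₂.Carrier
    ; op         = λ { (c₁ , c₂) as → M₁.op c₁ (fsts as) , M₂.op c₂ (snds as) }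
    ; D          = λ { (a , b) → M₁.D a × M₂.D b }
    ; D-nonempty = (proj₁ M₁.D-nonempty , proj₁ M₂.D-nonempty)
                 , (proj₂ M₁.D-nonempty , proj₂ M₂.D-nonempty)
    }
    where
      module M₁ = Matrix m₁
      module M₂ = Matrix m₂

  𝓜₁₂ : Matrix C₁₂ → Set₁
  𝓜₁₂ m = Σ (Matrix C₁) λ m₁ → Σ (Matrix C₂) λ m₂ →
          L₁.𝓜 m₁ × L₂.𝓜 m₂ × (m ≡ product m₁ m₂)

  L₁L₂ : MatrixLogic
  L₁L₂ = record
    { Con        = C₁₂
    ; Δ          = Δ₁₂
    ; 𝓜          = 𝓜₁₂
    ; 𝓜-nonempty = product (proj₁ L₁.𝓜-nonempty) (proj₁ L₂.𝓜-nonempty)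
                 , proj₁ L₁.𝓜-nonempty , proj₁ L₂.𝓜-nonempty
                 , proj₂ L₁.𝓜-nonempty , proj₂ L₂.𝓜-nonempty
                 , refl
    }

-- Every rule of 𝓛₁𝓛₂ preserves, on substitution instances, the property that both
-- projections are theorems.  A rule of 𝓛ₖ projects to an instance of itself on side k
-- and to a ⊤ⁿ-formula on the other side (tagging exists precisely so that the
-- conclusion is never a bare variable), lifting and co-lifting do not change
-- projections, and the ⊥-exchange rules never fire because a sound logic, in which ⊥
-- is undesignated, cannot prove ⊥.
module Submission where

open import Defs
open import Data.Product using (_×_; ∃; _,_; proj₁; proj₂)
open import Data.Nat using (ℕ; zero; suc; _≟_)
open import Data.Vec using (Vec; []; _∷_)
open import Data.List using ([]; _∷_; _++_)
open import Data.List.Relation.Unary.All as All using (All; []; _∷_)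
open import Data.List.Relation.Unary.Any using (here)
open import Data.List.Membership.Propositional using (_∈_)
open import Data.List.Membership.Propositional.Properties using (∈-++⁺ˡ; ∈-++⁺ʳ)
open import Data.Sum using (inj₁; inj₂)
open import Data.Empty using (⊥; ⊥-elim)
open import Relation.Nullary using (¬_; yes; no)
open import Relation.Binary.PropositionalEquality using (_≡_; refl; sym; trans; cong; cong₂; subst)

module _ {C : ℕ → Set} where

  mutual
    sub-sub : ∀ σ τ (φ : Fm C) → sub σ (sub τ φ) ≡ sub (λ i → sub σ (τ i)) φ
    sub-sub σ τ (var i)    = refl
    sub-sub σ τ (app c as) = cong (app c) (subs-subs σ τ as)

    subs-subs : ∀ σ τ {n} (as : Vec (Fm C) n) →
                subs σ (subs τ as) ≡ subs (λ i → sub σ (τ i)) as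
    subs-subs σ τ []       = refl
    subs-subs σ τ (a ∷ as) = cong₂ _∷_ (sub-sub σ τ a) (subs-subs σ τ as)

  Preserves : (Fm C → Set) → Rule C → Set
  Preserves P r = ∀ σ → All (λ α → P (sub σ α)) (prems r) → P (sub σ (concl r))

  Preserves-subRule : ∀ {P r} → Preserves P r → ∀ τ → Preserves P (subRule τ r)
  Preserves-subRule {P} {ps ⇒ β} preserves τ σ Pps =
    subst P (sym (sub-sub σ τ β)) (preserves (λ i → sub σ (τ i)) (All-subList⁻ ps Pps))
    where
      All-subList⁻ : ∀ qs → All (λ α → P (sub σ α)) (subList τ qs) →
                     All (λ α → P (sub (λ i → sub σ (τ i)) α)) qs
      All-subList⁻ []       []         = []
      All-subList⁻ (q ∷ qs) (Pq ∷ Pqs) = subst P (sub-sub σ τ q) Pq ∷ All-subList⁻ qs Pqs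

  module _ (Δ : Rule C → Set) where

    module _ {Γ : Fm C → Set} where
      open Derivations Δ Γ

      derivable-ind : (P : Fm C → Set) → (∀ {r} → Δ r → Preserves P r) →
                      (∀ {φ} → Γ φ → P φ) → ∀ {φ} → Derivable φ → P φ
      derivable-ind P closed hyp (_ , seq) = All.head (valid-ind seq)
        where
          valid-ind : ∀ {l} → ValidSeq l → All P l
          valid-ind []                                         = []
          valid-ind (inj₁ γ ∷ seq)                             = hyp γ ∷ valid-ind seq
          valid-ind (inj₂ (r , r∈Δ , σ , refl , earlier) ∷ seq) =
            closed r∈Δ σ (All.map (All.lookup Pseq) earlier) ∷ Pseq
            where Pseq = valid-ind seq

      Justified-mono : ∀ {l l′ φ} → (∀ {x} → x ∈ l → x ∈ l′) →
                       Justified l φ → Justified l′ φ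
      Justified-mono l⊆l′ (inj₁ γ) = inj₁ γ
      Justified-mono l⊆l′ (inj₂ (r , r∈Δ , σ , eq , earlier)) =
        inj₂ (r , r∈Δ , σ , eq , All.map l⊆l′ earlier)

      ValidSeq-++ : ∀ {l l′} → ValidSeq l → ValidSeq l′ → ValidSeq (l ++ l′)
      ValidSeq-++ []                seq′ = seq′
      ValidSeq-++ (justified ∷ seq) seq′ =
        Justified-mono ∈-++⁺ˡ justified ∷ ValidSeq-++ seq seq′

      derivables-in-one-sequence : ∀ {f : Fm C → Fm C} {αs} →
                                   All (λ α → Derivable (f α)) αs →
                                   ∃ λ l → ValidSeq l × All (λ α → f α ∈ l) αs
      derivables-in-one-sequence []                  = [] , [] , []
      derivables-in-one-sequence ((l , seq) ∷ ders) with derivables-in-one-sequence ders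
      ... | l′ , seq′ , φs∈l′ =
        _ , ValidSeq-++ seq seq′ , here refl ∷ All.map (∈-++⁺ʳ (_ ∷ l)) φs∈l′

      Derivable-closed : ∀ {r} → Δ r → Preserves Derivable r
      Derivable-closed {r} r∈Δ σ ders with derivables-in-one-sequence ders
      ... | l , seq , prems∈l = l , inj₂ (r , r∈Δ , σ , refl , prems∈l) ∷ seq

    Theorem : Fm C → Set
    Theorem = Derivations.Derivable Δ (λ _ → ⊥)

    Theorem-closed : ∀ {r} → Δ r → Preserves Theorem r
    Theorem-closed = Derivable-closed

    discharge : ∀ {α φ} → Theorem α → Derivations.Derivable Δ (_≡ α) φ → Theorem φ
    discharge ⊢α = derivable-ind Theorem Theorem-closed λ { refl → ⊢α }

module _ (L : MatrixLogic) (S : Standing L) where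
  open MatrixLogic L
  open Standing S

  ⊢⊤^ : ∀ n (φs : Vec (Fm Con) n) → Thm L (app (⊤^ n) φs)
  ⊢⊤^ zero    []  = ⊢tt
  ⊢⊤^ (suc n) φs = discharge Δ ⊢tt (tt⊢topⁿ n φs)

  Sound⇒⊬⊥ : Sound L → ¬ Thm L ⊥F
  Sound⇒⊬⊥ sound ⊢⊥ =
    let m , m∈𝓜 = 𝓜-nonempty
    in ff-undesignated m m∈𝓜
         (sound _ ⊥F ⊢⊥ m m∈𝓜 (λ _ → proj₁ (Matrix.D-nonempty m)) λ _ ())

module MeetCombination (L₁ L₂ : MatrixLogic) (S₁ : Standing L₁) (S₂ : Standing L₂) where
  open Combination L₁ L₂ S₁ S₂
  private
    module L₁ = MatrixLogic L₁
    module L₂ = MatrixLogic L₂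
    module S₁ = Standing S₁
    module S₂ = Standing S₂

  mutual
    ∣sub∣₁ : ∀ σ φ → ∣ sub σ φ ∣₁ ≡ sub (λ i → ∣ σ i ∣₁) ∣ φ ∣₁
    ∣sub∣₁ σ (var i)    = refl
    ∣sub∣₁ σ (app c as) = cong (app (proj₁ c)) (∣subs∣₁ σ as)

    ∣subs∣₁ : ∀ σ {n} (as : Vec (Fm C₁₂) n) →
              projs₁ (subs σ as) ≡ subs (λ i → ∣ σ i ∣₁) (projs₁ as)
    ∣subs∣₁ σ []       = refl
    ∣subs∣₁ σ (a ∷ as) = cong₂ _∷_ (∣sub∣₁ σ a) (∣subs∣₁ σ as)

  mutual
    ∣sub∣₂ : ∀ σ φ → ∣ sub σ φ ∣₂ ≡ sub (λ i → ∣ σ i ∣₂) ∣ φ ∣₂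
    ∣sub∣₂ σ (var i)    = refl
    ∣sub∣₂ σ (app c as) = cong (app (proj₂ c)) (∣subs∣₂ σ as)

    ∣subs∣₂ : ∀ σ {n} (as : Vec (Fm C₁₂) n) →
              projs₂ (subs σ as) ≡ subs (λ i → ∣ σ i ∣₂) (projs₂ as)
    ∣subs∣₂ σ []       = refl
    ∣subs∣₂ σ (a ∷ as) = cong₂ _∷_ (∣sub∣₂ σ a) (∣subs∣₂ σ as)

  mutual
    ∣emb₁∣₁ : ∀ φ → ∣ emb₁ φ ∣₁ ≡ φ
    ∣emb₁∣₁ (var i)    = refl
    ∣emb₁∣₁ (app c as) = cong (app c) (∣embs₁∣₁ as)

    ∣embs₁∣₁ : ∀ {n} (as : Vec (Fm L₁.Con) n) → projs₁ (embs₁ as) ≡ as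
    ∣embs₁∣₁ []       = refl
    ∣embs₁∣₁ (a ∷ as) = cong₂ _∷_ (∣emb₁∣₁ a) (∣embs₁∣₁ as)

  mutual
    ∣emb₂∣₂ : ∀ φ → ∣ emb₂ φ ∣₂ ≡ φ
    ∣emb₂∣₂ (var i)    = refl
    ∣emb₂∣₂ (app c as) = cong (app c) (∣embs₂∣₂ as)

    ∣embs₂∣₂ : ∀ {n} (as : Vec (Fm L₂.Con) n) → projs₂ (embs₂ as) ≡ as
    ∣embs₂∣₂ []       = refl
    ∣embs₂∣₂ (a ∷ as) = cong₂ _∷_ (∣emb₂∣₂ a) (∣embs₂∣₂ as)

  ∣sub-emb₁∣₁ : ∀ σ φ → ∣ sub σ (emb₁ φ) ∣₁ ≡ sub (λ i → ∣ σ i ∣₁) φ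
  ∣sub-emb₁∣₁ σ φ = trans (∣sub∣₁ σ (emb₁ φ)) (cong (sub _) (∣emb₁∣₁ φ))

  ∣sub-emb₂∣₂ : ∀ σ φ → ∣ sub σ (emb₂ φ) ∣₂ ≡ sub (λ i → ∣ σ i ∣₂) φ
  ∣sub-emb₂∣₂ σ φ = trans (∣sub∣₂ σ (emb₂ φ)) (cong (sub _) (∣emb₂∣₂ φ))

  Preserves-embRule₁ : ∀ {r} → Preserves (Thm L₁) r →
                       Preserves (λ φ → Thm L₁ ∣ φ ∣₁) (embRule₁ r)
  Preserves-embRule₁ {ps ⇒ β} preserves σ ⊢ps =
    subst (Thm L₁) (sym (∣sub-emb₁∣₁ σ β)) (preserves _ (All-embList₁⁻ ps ⊢ps))
    where
      All-embList₁⁻ : ∀ qs → All (λ α → Thm L₁ ∣ sub σ α ∣₁) (embList₁ qs) →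
                      All (λ α → Thm L₁ (sub (λ i → ∣ σ i ∣₁) α)) qs
      All-embList₁⁻ []       []         = []
      All-embList₁⁻ (q ∷ qs) (⊢q ∷ ⊢qs) =
        subst (Thm L₁) (∣sub-emb₁∣₁ σ q) ⊢q ∷ All-embList₁⁻ qs ⊢qs

  Preserves-embRule₂ : ∀ {r} → Preserves (Thm L₂) r →
                       Preserves (λ φ → Thm L₂ ∣ φ ∣₂) (embRule₂ r)
  Preserves-embRule₂ {ps ⇒ β} preserves σ ⊢ps =
    subst (Thm L₂) (sym (∣sub-emb₂∣₂ σ β)) (preserves _ (All-embList₂⁻ ps ⊢ps))
    where
      All-embList₂⁻ : ∀ qs → All (λ α → Thm L₂ ∣ sub σ α ∣₂) (embList₂ qs) →
                      All (λ α → Thm L₂ (sub (λ i → ∣ σ i ∣₂) α)) qs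
      All-embList₂⁻ []       []         = []
      All-embList₂⁻ (q ∷ qs) (⊢q ∷ ⊢qs) =
        subst (Thm L₂) (∣sub-emb₂∣₂ σ q) ⊢q ∷ All-embList₂⁻ qs ⊢qs

  -- The other component of an embedded constructor is some ⊤ⁿ.
  ⊢∣sub-emb₁∣₂ : ∀ {φ} → ¬ IsVar φ → ∀ σ → Thm L₂ ∣ sub σ (emb₁ φ) ∣₂
  ⊢∣sub-emb₁∣₂ {var i}    nonvar σ = ⊥-elim (nonvar (i , refl))
  ⊢∣sub-emb₁∣₂ {app c as} nonvar σ = ⊢⊤^ L₂ S₂ _ _

  ⊢∣sub-emb₂∣₁ : ∀ {φ} → ¬ IsVar φ → ∀ σ → Thm L₁ ∣ sub σ (emb₂ φ) ∣₁
  ⊢∣sub-emb₂∣₁ {var i}    nonvar σ = ⊥-elim (nonvar (i , refl))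
  ⊢∣sub-emb₂∣₁ {app c as} nonvar σ = ⊢⊤^ L₁ S₁ _ _

  tagRule-concl-nonvar : ∀ {C : ℕ → Set} (r : Rule C) {i} → concl r ≡ var i →
                         ∀ {n} (c : C n) → ¬ IsVar (concl (tagRule r i c))
  tagRule-concl-nonvar (ps ⇒ .(var i)) {i} refl c with i ≟ i
  ... | yes _  = λ ()
  ... | no i≢i = ⊥-elim (i≢i refl)

  ProjectionsThm : Fm C₁₂ → Set
  ProjectionsThm φ = Thm L₁ ∣ φ ∣₁ × Thm L₂ ∣ φ ∣₂

  module _ (⊬⊥₁ : ¬ Thm L₁ S₁.⊥F) (⊬⊥₂ : ¬ Thm L₂ S₂.⊥F) where

    Preserves-ProjectionsThm : ∀ {r} → Δ₁₂ r → Preserves ProjectionsThm r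
    Preserves-ProjectionsThm (plain₁ {r} r∈Δ nonvar) σ ⊢ps =
      Preserves-embRule₁ {r} (Theorem-closed L₁.Δ r∈Δ) σ (All.map proj₁ ⊢ps) ,
      ⊢∣sub-emb₁∣₂ nonvar σ
    Preserves-ProjectionsThm (plain₂ {r} r∈Δ nonvar) σ ⊢ps =
      ⊢∣sub-emb₂∣₁ nonvar σ ,
      Preserves-embRule₂ {r} (Theorem-closed L₂.Δ r∈Δ) σ (All.map proj₂ ⊢ps)
    Preserves-ProjectionsThm (tagged₁ {r} {i} r∈Δ concl≡i c) σ ⊢ps =
      Preserves-embRule₁ {tagRule r i c}
        (Preserves-subRule {P = Thm L₁} {r} (Theorem-closed L₁.Δ r∈Δ) _) σ (All.map proj₁ ⊢ps) ,
      ⊢∣sub-emb₁∣₂ (tagRule-concl-nonvar r concl≡i c) σ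
    Preserves-ProjectionsThm (tagged₂ {r} {i} r∈Δ concl≡i c) σ ⊢ps =
      ⊢∣sub-emb₂∣₁ (tagRule-concl-nonvar r concl≡i c) σ ,
      Preserves-embRule₂ {tagRule r i c}
        (Preserves-subRule {P = Thm L₂} {r} (Theorem-closed L₂.Δ r∈Δ) _) σ (All.map proj₂ ⊢ps)
    Preserves-ProjectionsThm (lift φ) σ ((⊢φ₁ , _) ∷ (_ , ⊢φ₂) ∷ []) =
      subst (Thm L₁) (trans (∣sub-emb₁∣₁ σ ∣ φ ∣₁) (sym (∣sub∣₁ σ φ))) ⊢φ₁ ,
      subst (Thm L₂) (trans (∣sub-emb₂∣₂ σ ∣ φ ∣₂) (sym (∣sub∣₂ σ φ))) ⊢φ₂
    Preserves-ProjectionsThm (colift₁ (var i)) σ (⊢φ ∷ []) = ⊢φ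
    Preserves-ProjectionsThm (colift₁ (app c as)) σ ((⊢φ₁ , _) ∷ []) =
      subst (Thm L₁) (trans (∣sub∣₁ σ (app c as)) (sym (∣sub-emb₁∣₁ σ ∣ app c as ∣₁))) ⊢φ₁ ,
      ⊢∣sub-emb₁∣₂ {∣ app c as ∣₁} (λ ()) σ
    Preserves-ProjectionsThm (colift₂ (var i)) σ (⊢φ ∷ []) = ⊢φ
    Preserves-ProjectionsThm (colift₂ (app c as)) σ ((_ , ⊢φ₂) ∷ []) =
      ⊢∣sub-emb₂∣₁ {∣ app c as ∣₂} (λ ()) σ ,
      subst (Thm L₂) (trans (∣sub∣₂ σ (app c as)) (sym (∣sub-emb₂∣₂ σ ∣ app c as ∣₂))) ⊢φ₂
    Preserves-ProjectionsThm bot₁₂ σ ((⊢⊥₁ , _) ∷ []) = ⊥-elim (⊬⊥₁ ⊢⊥₁)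
    Preserves-ProjectionsThm bot₂₁ σ ((_ , ⊢⊥₂) ∷ []) = ⊥-elim (⊬⊥₂ ⊢⊥₂)

    Thm₁₂⇒ProjectionsThm : ∀ {ψ} → Thm L₁L₂ ψ → ProjectionsThm ψ
    Thm₁₂⇒ProjectionsThm = derivable-ind Δ₁₂ ProjectionsThm Preserves-ProjectionsThm λ ()

proposition3p3 : (L₁ L₂ : MatrixLogic) (S₁ : Standing L₁) (S₂ : Standing L₂) →
    Sound L₁ → Sound L₂ →
    (ψ : Fm (Combination.C₁₂ L₁ L₂ S₁ S₂)) →
    Thm (Combination.L₁L₂ L₁ L₂ S₁ S₂) ψ →
    Thm L₁ (Combination.∣_∣₁ L₁ L₂ S₁ S₂ ψ) × Thm L₂ (Combination.∣_∣₂ L₁ L₂ S₁ S₂ ψ)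
proposition3p3 L₁ L₂ S₁ S₂ sound₁ sound₂ ψ =
  MeetCombination.Thm₁₂⇒ProjectionsThm L₁ L₂ S₁ S₂
    (Sound⇒⊬⊥ L₁ S₁ sound₁) (Sound⇒⊬⊥ L₂ S₂ sound₂)
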